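{- Let $S_j=(x_j,y_j)\in\mathbb{R}^2$, $j=1,2,3,4$, with $x_1\le x_2\le x_3\le x_4$, and let $\delta_1,\dots,\delta_4$ be positive integers. For $i\in\{2,3\}$ define the pivot point $P_i=(\tilde x_i,\tilde y_i)$ by $$\tilde x_i=x_i+\frac{\sum_{j=1}^4\delta_j(x_j-x_i)^2}{\sum_{j=1}^4\delta_j(x_j-x_i)},\qquad \tilde y_i=y_i+\frac{\sum_{j=1}^4\delta_j(x_j-x_i)(y_j-y_i)}{\sum_{j=1}^4\delta_j(x_j-x_i)},$$ whenever the denominator is nonzero. (a) If $S_1,S_3,S_4$ are not collinear and $(\lambda_1,\lambda_3,\lambda_4)$ are the barycentric coordinates of $P_2$ with respect to the triangle $S_1S_3S_4$, then either $\lambda_1\ge 0\ge\lambda_3,\lambda_4$ or $\lambda_1\le 0\le \lambda_3,\lambda_4$ (i.e. $P_2$ lies in the sign region $(+,-,-)$ or $(-,+,+)$). (b) If $S_1,S_2,S_4$ are not collinear and $(\lambda_1,\lambda_2,\lambda_4)$ are the barycentric coordinates of $P_3$ with respect to the triangle $S_1S_2S_4$, then either $\lambda_1,\lambda_2\ge 0\ge\lambda_4$ or $\lambda_1,\lambda_2\le 0\le\lambda_4$ (i.e. $P_3$ lies in the sign region $(+,+,-)$ or $(-,-,+)$).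
   Context: Here $\delta_j=k_j+1$, where $k_j\in\mathbb{N}$ is the number of repetitions of $S_j$, so $S_j$ appears $\delta_j$ times in the data. Barycentric coordinates of a point $Q$ with respect to a non-degenerate triangle $ABC$ are the unique reals $(\lambda_A,\lambda_B,\lambda_C)$ with $\lambda_A+\lambda_B+\lambda_C=1$ and $Q=\lambda_A A+\lambda_B B+\lambda_C C$; the signs of these coordinates determine which of the seven regions of the plane cut out by the triangle's edge lines contains $Q$. -}

module Defs where

open import Level using (0ℓ)
open import Data.Nat as ℕ using (ℕ; zero; suc)
open import Data.Product using (_×_)
open import Data.Sum using (_⊎_)
open import Relation.Binary.PropositionalEquality using (_≡_; _≢_)
open import Relation.Binary.Structures using (IsTotalOrder)
open import Algebra.Structures using (IsCommutativeRing)

-- An ordered field (standard axioms), with propositional equality on the carrier.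
-- The real numbers are the intended model; the paper's statement is about ℝ.
record OrderedField : Set₁ where
  infixl 6 _+_ _-_
  infixl 7 _*_
  infix 4 _≤_
  field
    Carrier : Set
    _+_ _*_ : Carrier → Carrier → Carrier
    -_      : Carrier → Carrier
    0# 1#   : Carrier
    _≤_     : Carrier → Carrier → Set
    isCommutativeRing : IsCommutativeRing _≡_ _+_ _*_ -_ 0# 1#
    0≢1     : 0# ≢ 1#
    inv     : (x : Carrier) → x ≢ 0# → Carrier
    inv-r   : (x : Carrier) (nz : x ≢ 0#) → x * inv x nz ≡ 1#
    isTotalOrder : IsTotalOrder _≡_ _≤_
    +-mono-≤ : ∀ {x y} z → x ≤ y → x + z ≤ y + z
    *-nonneg : ∀ {x y} → 0# ≤ x → 0# ≤ y → 0# ≤ x * y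

  _-_ : Carrier → Carrier → Carrier
  x - y = x + (- y)

  fromℕ : ℕ → Carrier
  fromℕ zero    = 0#
  fromℕ (suc n) = 1# + fromℕ n

module Pivot (F : OrderedField) where
  open OrderedField F

  record Data4 : Set where
    field
      x₁ x₂ x₃ x₄ y₁ y₂ y₃ y₄ : Carrier
      δ₁ δ₂ δ₃ δ₄ : ℕ

  module _ (d : Data4) where
    open Data4 d

    Den : Carrier → Carrier
    Den xi = fromℕ δ₁ * (x₁ - xi) + fromℕ δ₂ * (x₂ - xi)
           + fromℕ δ₃ * (x₃ - xi) + fromℕ δ₄ * (x₄ - xi)

    NumX : Carrier → Carrier
    NumX xi = fromℕ δ₁ * ((x₁ - xi) * (x₁ - xi)) + fromℕ δ₂ * ((x₂ - xi) * (x₂ - xi))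
            + fromℕ δ₃ * ((x₃ - xi) * (x₃ - xi)) + fromℕ δ₄ * ((x₄ - xi) * (x₄ - xi))

    NumY : Carrier → Carrier → Carrier
    NumY xi yi = fromℕ δ₁ * ((x₁ - xi) * (y₁ - yi)) + fromℕ δ₂ * ((x₂ - xi) * (y₂ - yi))
               + fromℕ δ₃ * ((x₃ - xi) * (y₃ - yi)) + fromℕ δ₄ * ((x₄ - xi) * (y₄ - yi))

    pivotX : (xi : Carrier) → Den xi ≢ 0# → Carrier
    pivotX xi nz = xi + NumX xi * inv (Den xi) nz

    pivotY : (xi yi : Carrier) → Den xi ≢ 0# → Carrier
    pivotY xi yi nz = yi + NumY xi yi * inv (Den xi) nz

  Collinear : (ax ay bx by cx cy : Carrier) → Set
  Collinear ax ay bx by cx cy = (bx - ax) * (cy - ay) - (cx - ax) * (by - ay) ≡ 0#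

  IsBarycentric : (ax ay bx by cx cy qx qy la lb lc : Carrier) → Set
  IsBarycentric ax ay bx by cx cy qx qy la lb lc =
    (la + lb + lc ≡ 1#) × (qx ≡ la * ax + lb * bx + lc * cx) × (qy ≡ la * ay + lb * by + lc * cy)

-- For a pivot index i, write D = Σⱼ δⱼ (xⱼ - xᵢ) and I = 1/D.  Both coordinates
-- of Pᵢ are of the form  eᵢ + (Σⱼ δⱼ (xⱼ - xᵢ)(vⱼ - eᵢ)) I,  and a direct
-- computation shows that this equals Σⱼ ωⱼ vⱼ with weights ωⱼ = δⱼ (xⱼ - xᵢ) I,
-- which sum to D I = 1.  The weight of Sᵢ itself vanishes, so Pᵢ is the affine
-- combination of the other three points with weights ωⱼ.  Barycentric
-- coordinates with respect to a non-degenerate triangle are unique (Cramer's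
-- rule), hence λⱼ = ωⱼ.  Since δⱼ ≥ 0, the sign of ωⱼ is the sign of xⱼ - xᵢ
-- times the sign of I; the ordering x₁ ≤ x₂ ≤ x₃ ≤ x₄ then gives the regions.

module Submission where

open import Level using (0ℓ)
open import Data.Nat as ℕ using (ℕ; zero; suc)
import Data.Nat.Properties as ℕP
open import Data.Integer as ℤ using (ℤ; +_; -[1+_]; _⊖_; _◃_)
import Data.Integer.Properties as ℤP
open import Data.Sign as Sign using (Sign)
open import Data.Maybe using (just; nothing)
open import Data.Product using (_×_; _,_; proj₁; proj₂)
open import Data.Sum using (_⊎_; inj₁; inj₂)
open import Relation.Nullary using (¬_; yes; no)
open import Relation.Binary.Definitions using (WeaklyDecidable)
open import Relation.Binary.PropositionalEquality as ≡ using (_≡_; _≢_)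
open import Relation.Binary.Structures using (IsTotalOrder)
open import Algebra.Bundles using (CommutativeRing)
open import Algebra.Solver.Ring.AlmostCommutativeRing
  using (_-Raw-AlmostCommutative⟶_; Induced-equivalence; fromCommutativeRing)
open import Defs

-- Every commutative ring receives a ring map from ℤ; using integer
-- coefficients makes the stdlib's ring solver available for the ring.
module IntegerCoefficients {c ℓ} (R : CommutativeRing c ℓ) where

  open CommutativeRing R
  open import Algebra.Properties.Semiring.Mult semiring using (×-homo-+; ×1-homo-*)
    renaming (_×_ to _·_)
  open import Algebra.Properties.Ring ring using (-1*x≈-x)
  open import Algebra.Properties.AbelianGroup +-abelianGroup
    using (⁻¹-∙-comm; ⁻¹-involutive; ε⁻¹≈ε; xyx⁻¹≈y)
  open import Relation.Binary.Reasoning.Setoid setoid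

  fromℤ : ℤ → Carrier
  fromℤ (+ n)    = n · 1#
  fromℤ -[1+ n ] = - (suc n · 1#)

  fromSign : Sign → Carrier
  fromSign Sign.+ = 1#
  fromSign Sign.- = - 1#

  fromSign-* : ∀ s t → fromSign (s Sign.* t) ≈ fromSign s * fromSign t
  fromSign-* Sign.+ t      = sym (*-identityˡ _)
  fromSign-* Sign.- Sign.+ = sym (*-identityʳ _)
  fromSign-* Sign.- Sign.- = sym (trans (-1*x≈-x (- 1#)) (⁻¹-involutive 1#))

  fromℤ-◃ : ∀ s n → fromℤ (s ◃ n) ≈ fromSign s * (n · 1#)
  fromℤ-◃ s      zero    = sym (zeroʳ _)
  fromℤ-◃ Sign.+ (suc n) = sym (*-identityˡ _)
  fromℤ-◃ Sign.- (suc n) = sym (-1*x≈-x _)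

  fromℤ-sign-abs : ∀ i → fromℤ i ≈ fromSign (ℤ.sign i) * (ℤ.∣ i ∣ · 1#)
  fromℤ-sign-abs i = trans (reflexive (≡.cong fromℤ (≡.sym (ℤP.◃-inverse i))))
                           (fromℤ-◃ (ℤ.sign i) ℤ.∣ i ∣)

  *-interchange : ∀ a b c d → (a * b) * (c * d) ≈ (a * c) * (b * d)
  *-interchange a b c d = begin
    (a * b) * (c * d) ≈⟨ *-assoc a b (c * d) ⟩
    a * (b * (c * d)) ≈⟨ *-congˡ (sym (*-assoc b c d)) ⟩
    a * ((b * c) * d) ≈⟨ *-congˡ (*-congʳ (*-comm b c)) ⟩
    a * ((c * b) * d) ≈⟨ *-congˡ (*-assoc c b d) ⟩
    a * (c * (b * d)) ≈⟨ sym (*-assoc a c (b * d)) ⟩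
    (a * c) * (b * d) ∎

  fromℤ-* : ∀ i j → fromℤ (i ℤ.* j) ≈ fromℤ i * fromℤ j
  fromℤ-* i j = begin
    fromℤ (i ℤ.* j)                          ≈⟨ fromℤ-◃ (s Sign.* t) (m ℕ.* n) ⟩
    fromSign (s Sign.* t) * ((m ℕ.* n) · 1#) ≈⟨ *-cong (fromSign-* s t) (×1-homo-* m n) ⟩
    (σ * τ) * ((m · 1#) * (n · 1#))          ≈⟨ *-interchange σ τ (m · 1#) (n · 1#) ⟩
    (σ * (m · 1#)) * (τ * (n · 1#))          ≈⟨ *-cong (fromℤ-sign-abs i) (fromℤ-sign-abs j) ⟨
    fromℤ i * fromℤ j                        ∎
    where s = ℤ.sign i; t = ℤ.sign j; m = ℤ.∣ i ∣; n = ℤ.∣ j ∣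
          σ = fromSign s; τ = fromSign t

  fromℤ-⊖ : ∀ m n → fromℤ (m ⊖ n) ≈ m · 1# - n · 1#
  fromℤ-⊖ m       zero    = sym (trans (+-congˡ ε⁻¹≈ε) (+-identityʳ _))
  fromℤ-⊖ zero    (suc n) = sym (+-identityˡ _)
  fromℤ-⊖ (suc m) (suc n) = begin
    fromℤ (suc m ⊖ suc n)  ≡⟨ ≡.cong fromℤ (ℤP.[1+m]⊖[1+n]≡m⊖n m n) ⟩
    fromℤ (m ⊖ n)          ≈⟨ fromℤ-⊖ m n ⟩
    a - b                  ≈⟨ xyx⁻¹≈y 1# (a - b) ⟨
    1# + (a - b) - 1#      ≈⟨ +-congʳ (+-assoc 1# a (- b)) ⟨
    (1# + a) - b - 1#      ≈⟨ +-assoc (1# + a) (- b) (- 1#) ⟩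
    (1# + a) + (- b - 1#)  ≈⟨ +-congˡ (trans (+-comm (- b) (- 1#)) (⁻¹-∙-comm 1# b)) ⟩
    (1# + a) - (1# + b)    ∎
    where a = m · 1#; b = n · 1#

  fromℤ-+ : ∀ i j → fromℤ (i ℤ.+ j) ≈ fromℤ i + fromℤ j
  fromℤ-+ -[1+ m ] -[1+ n ] = begin
    - (suc (suc (m ℕ.+ n)) · 1#)     ≡⟨ ≡.cong (λ k → - (k · 1#)) (≡.sym (ℕP.+-suc (suc m) n)) ⟩
    - ((suc m ℕ.+ suc n) · 1#)       ≈⟨ -‿cong (×-homo-+ 1# (suc m) (suc n)) ⟩
    - (suc m · 1# + suc n · 1#)      ≈⟨ ⁻¹-∙-comm _ _ ⟨
    - (suc m · 1#) + - (suc n · 1#)  ∎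
  fromℤ-+ -[1+ m ] (+ n)    = trans (fromℤ-⊖ n (suc m)) (+-comm _ _)
  fromℤ-+ (+ m)    -[1+ n ] = fromℤ-⊖ m (suc n)
  fromℤ-+ (+ m)    (+ n)    = ×-homo-+ 1# m n

  fromℤ-neg : ∀ i → fromℤ (ℤ.- i) ≈ - fromℤ i
  fromℤ-neg -[1+ n ]  = sym (⁻¹-involutive _)
  fromℤ-neg (+ zero)  = sym ε⁻¹≈ε
  fromℤ-neg (+ suc n) = refl

  fromℤ-homomorphism : CommutativeRing.rawRing ℤP.+-*-commutativeRing
                         -Raw-AlmostCommutative⟶ fromCommutativeRing R
  fromℤ-homomorphism = record
    { ⟦_⟧ = fromℤ ; +-homo = fromℤ-+ ; *-homo = fromℤ-* ; -‿homo = fromℤ-neg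
    ; 0-homo = refl ; 1-homo = +-identityʳ 1# }

  -- Equal integer coefficients have equal images; this is all the solver needs.
  _≟-coefficient_ : WeaklyDecidable (Induced-equivalence fromℤ-homomorphism)
  i ≟-coefficient j with i ℤ.≟ j
  ... | yes ≡.refl = just refl
  ... | no _       = nothing

  open import Algebra.Solver.Ring _ _ fromℤ-homomorphism _≟-coefficient_ public
    using (solve; _:=_; _:+_; _:*_; _:-_; :-_)

module OrderedFieldProperties (F : OrderedField) where
  open OrderedField F
  open IsTotalOrder isTotalOrder public using (total) renaming (trans to ≤-trans)
  open ≡ using (refl; subst; subst₂; cong)

  commutativeRing : CommutativeRing 0ℓ 0ℓ
  commutativeRing = record { isCommutativeRing = isCommutativeRing }

  open CommutativeRing commutativeRing
    using (+-identityˡ; *-identityʳ; *-assoc; -‿inverseˡ; -‿inverseʳ; *-comm; ring)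
  open import Algebra.Properties.Ring ring using (-‿distribˡ-*)
  open import Algebra.Properties.Ring ring public using (+-cancelʳ)
  open IntegerCoefficients commutativeRing public
  open ≡.≡-Reasoning

  *-cancelʳ : ∀ {a b c} → c ≢ 0# → a * c ≡ b * c → a ≡ b
  *-cancelʳ {a} {b} {c} c≢0 ac≡bc = begin
    a                    ≡⟨ ≡.sym (*-identityʳ a) ⟩
    a * 1#               ≡⟨ cong (a *_) (≡.sym (inv-r c c≢0)) ⟩
    a * (c * inv c c≢0)  ≡⟨ ≡.sym (*-assoc a c _) ⟩
    a * c * inv c c≢0    ≡⟨ cong (_* inv c c≢0) ac≡bc ⟩
    b * c * inv c c≢0    ≡⟨ *-assoc b c _ ⟩
    b * (c * inv c c≢0)  ≡⟨ cong (b *_) (inv-r c c≢0) ⟩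
    b * 1#               ≡⟨ *-identityʳ b ⟩
    b                    ∎

  neg-nonneg : ∀ {x} → x ≤ 0# → 0# ≤ - x
  neg-nonneg {x} x≤0 = subst₂ _≤_ (-‿inverseʳ x) (+-identityˡ (- x)) (+-mono-≤ (- x) x≤0)

  nonpos-from-neg : ∀ {x} → 0# ≤ - x → x ≤ 0#
  nonpos-from-neg {x} 0≤-x = subst₂ _≤_ (+-identityˡ x) (-‿inverseˡ x) (+-mono-≤ x 0≤-x)

  sub-nonneg : ∀ {x y} → x ≤ y → 0# ≤ y - x
  sub-nonneg {x} {y} x≤y = subst (_≤ y - x) (-‿inverseʳ x) (+-mono-≤ (- x) x≤y)

  sub-nonpos : ∀ {x y} → x ≤ y → x - y ≤ 0#
  sub-nonpos {x} {y} x≤y = subst (x - y ≤_) (-‿inverseʳ y) (+-mono-≤ (- y) x≤y)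

  *-nonpos-nonneg : ∀ {a b} → a ≤ 0# → 0# ≤ b → a * b ≤ 0#
  *-nonpos-nonneg {a} {b} a≤0 0≤b =
    nonpos-from-neg (subst (0# ≤_) (≡.sym (-‿distribˡ-* a b)) (*-nonneg (neg-nonneg a≤0) 0≤b))

  *-nonneg-nonpos : ∀ {a b} → 0# ≤ a → b ≤ 0# → a * b ≤ 0#
  *-nonneg-nonpos {a} {b} 0≤a b≤0 = subst (_≤ 0#) (*-comm b a) (*-nonpos-nonneg b≤0 0≤a)

  neg*neg : ∀ a b → - a * - b ≡ a * b
  neg*neg = solve 2 (λ a b → (:- a) :* (:- b) := a :* b) refl

  *-nonpos-nonpos : ∀ {a b} → a ≤ 0# → b ≤ 0# → 0# ≤ a * b
  *-nonpos-nonpos {a} {b} a≤0 b≤0 =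
    subst (0# ≤_) (neg*neg a b) (*-nonneg (neg-nonneg a≤0) (neg-nonneg b≤0))

  -- If 1 ≤ 0 then 0 ≤ 1 · 1 by the (-,-) rule, so 0 ≤ 1 in any case.
  0≤1 : 0# ≤ 1#
  0≤1 with total 0# 1#
  ... | inj₁ 0≤1 = 0≤1
  ... | inj₂ 1≤0 = subst (0# ≤_) (*-identityʳ 1#) (*-nonpos-nonpos 1≤0 1≤0)

  +-nonneg : ∀ {a b} → 0# ≤ a → 0# ≤ b → 0# ≤ a + b
  +-nonneg {a} {b} 0≤a 0≤b = ≤-trans 0≤b (subst (_≤ a + b) (+-identityˡ b) (+-mono-≤ b 0≤a))

  fromℕ-nonneg : ∀ n → 0# ≤ fromℕ n
  fromℕ-nonneg zero    = IsTotalOrder.refl isTotalOrder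
  fromℕ-nonneg (suc n) = +-nonneg 0≤1 (fromℕ-nonneg n)

module Barycentric (F : OrderedField) where
  open OrderedField F
  open OrderedFieldProperties F using (solve; _:=_; _:+_; _:*_; _:-_; *-cancelʳ; +-cancelʳ)
  open Pivot F using (Collinear; IsBarycentric)
  open ≡ using (refl; cong; cong₂)
  open ≡.≡-Reasoning

  cross : (ax ay bx by cx cy : Carrier) → Carrier
  cross ax ay bx by cx cy = (bx - ax) * (cy - ay) - (cx - ax) * (by - ay)

  relative-to-first : ∀ {la lb lc} a b c → la + lb + lc ≡ 1# →
    (la * a + lb * b + lc * c) - a ≡ lb * (b - a) + lc * (c - a)
  relative-to-first {la} {lb} {lc} a b c sum≡1 = begin
    Σ - a                   ≡⟨ cong (λ t → Σ - t) (≡.sym (≡.trans (cong (_* a) sum≡1) (*-identityˡ a))) ⟩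
    Σ - (la + lb + lc) * a  ≡⟨ expand la lb lc a b c ⟩
    lb * (b - a) + lc * (c - a) ∎
    where
    Σ = la * a + lb * b + lc * c
    open CommutativeRing (OrderedFieldProperties.commutativeRing F) using (*-identityˡ)
    expand : ∀ la lb lc a b c →
      (la * a + lb * b + lc * c) - (la + lb + lc) * a ≡ lb * (b - a) + lc * (c - a)
    expand = solve 6 (λ la lb lc a b c →
      (la :* a :+ lb :* b :+ lc :* c) :- (la :+ lb :+ lc) :* a := lb :* (b :- a) :+ lc :* (c :- a)) refl

  -- Cramer's rule for the 2 × 2 system p = β b₁ + γ c₁, q = β b₂ + γ c₂.
  cramer-β : ∀ β γ b₁ b₂ c₁ c₂ →
    β * (b₁ * c₂ - c₁ * b₂) ≡ (β * b₁ + γ * c₁) * c₂ - c₁ * (β * b₂ + γ * c₂)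
  cramer-β = solve 6 (λ β γ b₁ b₂ c₁ c₂ →
    β :* (b₁ :* c₂ :- c₁ :* b₂) := (β :* b₁ :+ γ :* c₁) :* c₂ :- c₁ :* (β :* b₂ :+ γ :* c₂)) refl

  cramer-γ : ∀ β γ b₁ b₂ c₁ c₂ →
    γ * (b₁ * c₂ - c₁ * b₂) ≡ b₁ * (β * b₂ + γ * c₂) - (β * b₁ + γ * c₁) * b₂
  cramer-γ = solve 6 (λ β γ b₁ b₂ c₁ c₂ →
    γ :* (b₁ :* c₂ :- c₁ :* b₂) := b₁ :* (β :* b₂ :+ γ :* c₂) :- (β :* b₁ :+ γ :* c₁) :* b₂) refl

  barycentric-areas : ∀ {ax ay bx by cx cy qx qy la lb lc} →
    IsBarycentric ax ay bx by cx cy qx qy la lb lc →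
    (lb * cross ax ay bx by cx cy ≡ cross ax ay qx qy cx cy) ×
    (lc * cross ax ay bx by cx cy ≡ cross ax ay bx by qx qy)
  barycentric-areas {ax} {ay} {bx} {by} {cx} {cy} {qx} {qy} {la} {lb} {lc} (sum≡1 , qx≡ , qy≡) =
      ≡.trans (cramer-β lb lc (bx - ax) (by - ay) (cx - ax) (cy - ay))
              (cong₂ (λ p q → p * (cy - ay) - (cx - ax) * q) (≡.sym Δx) (≡.sym Δy))
    , ≡.trans (cramer-γ lb lc (bx - ax) (by - ay) (cx - ax) (cy - ay))
              (cong₂ (λ p q → (bx - ax) * q - p * (by - ay)) (≡.sym Δx) (≡.sym Δy))
    where
    Δx : qx - ax ≡ lb * (bx - ax) + lc * (cx - ax)
    Δx = ≡.trans (cong (_- ax) qx≡) (relative-to-first ax bx cx sum≡1)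
    Δy : qy - ay ≡ lb * (by - ay) + lc * (cy - ay)
    Δy = ≡.trans (cong (_- ay) qy≡) (relative-to-first ay by cy sum≡1)

  barycentric-unique : ∀ {ax ay bx by cx cy qx qy la lb lc ma mb mc} →
    ¬ Collinear ax ay bx by cx cy →
    IsBarycentric ax ay bx by cx cy qx qy la lb lc →
    IsBarycentric ax ay bx by cx cy qx qy ma mb mc →
    (la ≡ ma) × (lb ≡ mb) × (lc ≡ mc)
  barycentric-unique {la = la} {lb} {lc} {ma} {mb} {mc} non-collinear l m =
    la≡ma , lb≡mb , lc≡mc
    where
    lb≡mb : lb ≡ mb
    lb≡mb = *-cancelʳ non-collinear
              (≡.trans (proj₁ (barycentric-areas l)) (≡.sym (proj₁ (barycentric-areas m))))
    lc≡mc : lc ≡ mc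
    lc≡mc = *-cancelʳ non-collinear
              (≡.trans (proj₂ (barycentric-areas l)) (≡.sym (proj₂ (barycentric-areas m))))
    -- both triples sum to 1, so the first coordinates agree too
    la≡ma : la ≡ ma
    la≡ma = +-cancelʳ lb la ma (+-cancelʳ lc (la + lb) (ma + lb) (begin
      la + lb + lc ≡⟨ proj₁ l ⟩
      1#           ≡⟨ ≡.sym (proj₁ m) ⟩
      ma + mb + mc ≡⟨ cong₂ (λ u v → ma + u + v) (≡.sym lb≡mb) (≡.sym lc≡mc) ⟩
      ma + lb + lc ∎))

module PivotRegions (F : OrderedField) (d : Pivot.Data4 F) where
  open OrderedField F
  open OrderedFieldProperties F
  open Barycentric F using (barycentric-unique)
  open Pivot F
  open Data4 d
  open ≡ using (refl; cong)

  -- Weight of a point with abscissa u and multiplicity δ in the pivot at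
  -- abscissa c, where I is the reciprocal of the denominator Den c.
  weight : ℕ → Carrier → Carrier → Carrier → Carrier
  weight δ u c I = fromℕ δ * ((u - c) * I)

  weight-right-nonneg : ∀ δ {u c I} → c ≤ u → 0# ≤ I → 0# ≤ weight δ u c I
  weight-right-nonneg δ c≤u 0≤I = *-nonneg (fromℕ-nonneg δ) (*-nonneg (sub-nonneg c≤u) 0≤I)

  weight-left-nonpos : ∀ δ {u c I} → u ≤ c → 0# ≤ I → weight δ u c I ≤ 0#
  weight-left-nonpos δ u≤c 0≤I = *-nonneg-nonpos (fromℕ-nonneg δ) (*-nonpos-nonneg (sub-nonpos u≤c) 0≤I)

  weight-right-nonpos : ∀ δ {u c I} → c ≤ u → I ≤ 0# → weight δ u c I ≤ 0#
  weight-right-nonpos δ c≤u I≤0 = *-nonneg-nonpos (fromℕ-nonneg δ) (*-nonneg-nonpos (sub-nonneg c≤u) I≤0)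

  weight-left-nonneg : ∀ δ {u c I} → u ≤ c → I ≤ 0# → 0# ≤ weight δ u c I
  weight-left-nonneg δ u≤c I≤0 = *-nonneg (fromℕ-nonneg δ) (*-nonpos-nonpos (sub-nonpos u≤c) I≤0)

  -- Σⱼ δⱼ (xⱼ - c)(vⱼ - e); NumX and NumY are its instances v = x and v = y.
  moment : (c e v₁ v₂ v₃ v₄ : Carrier) → Carrier
  moment c e v₁ v₂ v₃ v₄ =
    fromℕ δ₁ * ((x₁ - c) * (v₁ - e)) + fromℕ δ₂ * ((x₂ - c) * (v₂ - e))
    + fromℕ δ₃ * ((x₃ - c) * (v₃ - e)) + fromℕ δ₄ * ((x₄ - c) * (v₄ - e))

  scale-centre : ∀ {c} e M I → Den d c * I ≡ 1# → e + M * I ≡ e * (Den d c * I) + M * I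
  scale-centre e M I DI≡1 =
    cong (_+ M * I) (≡.sym (≡.trans (cong (e *_) DI≡1) (CommutativeRing.*-identityʳ commutativeRing e)))

  weight-sum₂ : ∀ I → weight δ₁ x₁ x₂ I + weight δ₃ x₃ x₂ I + weight δ₄ x₄ x₂ I ≡ Den d x₂ * I
  weight-sum₂ = solve 9 (λ D₁ D₂ D₃ D₄ u₁ u₂ u₃ u₄ I →
    D₁ :* ((u₁ :- u₂) :* I) :+ D₃ :* ((u₃ :- u₂) :* I) :+ D₄ :* ((u₄ :- u₂) :* I)
    := (D₁ :* (u₁ :- u₂) :+ D₂ :* (u₂ :- u₂) :+ D₃ :* (u₃ :- u₂) :+ D₄ :* (u₄ :- u₂)) :* I)
    refl (fromℕ δ₁) (fromℕ δ₂) (fromℕ δ₃) (fromℕ δ₄) x₁ x₂ x₃ x₄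

  weight-sum₃ : ∀ I → weight δ₁ x₁ x₃ I + weight δ₂ x₂ x₃ I + weight δ₄ x₄ x₃ I ≡ Den d x₃ * I
  weight-sum₃ = solve 9 (λ D₁ D₂ D₃ D₄ u₁ u₂ u₃ u₄ I →
    D₁ :* ((u₁ :- u₃) :* I) :+ D₂ :* ((u₂ :- u₃) :* I) :+ D₄ :* ((u₄ :- u₃) :* I)
    := (D₁ :* (u₁ :- u₃) :+ D₂ :* (u₂ :- u₃) :+ D₃ :* (u₃ :- u₃) :+ D₄ :* (u₄ :- u₃)) :* I)
    refl (fromℕ δ₁) (fromℕ δ₂) (fromℕ δ₃) (fromℕ δ₄) x₁ x₂ x₃ x₄

  shifted-mean₂ : ∀ v₁ v₂ v₃ v₄ e I →
    e * (Den d x₂ * I) + moment x₂ e v₁ v₂ v₃ v₄ * I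
    ≡ weight δ₁ x₁ x₂ I * v₁ + weight δ₃ x₃ x₂ I * v₃ + weight δ₄ x₄ x₂ I * v₄
  shifted-mean₂ = solve 14 (λ D₁ D₂ D₃ D₄ u₁ u₂ u₃ u₄ v₁ v₂ v₃ v₄ e I →
    e :* ((D₁ :* (u₁ :- u₂) :+ D₂ :* (u₂ :- u₂) :+ D₃ :* (u₃ :- u₂) :+ D₄ :* (u₄ :- u₂)) :* I)
    :+ (D₁ :* ((u₁ :- u₂) :* (v₁ :- e)) :+ D₂ :* ((u₂ :- u₂) :* (v₂ :- e))
        :+ D₃ :* ((u₃ :- u₂) :* (v₃ :- e)) :+ D₄ :* ((u₄ :- u₂) :* (v₄ :- e))) :* I
    := D₁ :* ((u₁ :- u₂) :* I) :* v₁ :+ D₃ :* ((u₃ :- u₂) :* I) :* v₃ :+ D₄ :* ((u₄ :- u₂) :* I) :* v₄)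
    refl (fromℕ δ₁) (fromℕ δ₂) (fromℕ δ₃) (fromℕ δ₄) x₁ x₂ x₃ x₄

  shifted-mean₃ : ∀ v₁ v₂ v₃ v₄ e I →
    e * (Den d x₃ * I) + moment x₃ e v₁ v₂ v₃ v₄ * I
    ≡ weight δ₁ x₁ x₃ I * v₁ + weight δ₂ x₂ x₃ I * v₂ + weight δ₄ x₄ x₃ I * v₄
  shifted-mean₃ = solve 14 (λ D₁ D₂ D₃ D₄ u₁ u₂ u₃ u₄ v₁ v₂ v₃ v₄ e I →
    e :* ((D₁ :* (u₁ :- u₃) :+ D₂ :* (u₂ :- u₃) :+ D₃ :* (u₃ :- u₃) :+ D₄ :* (u₄ :- u₃)) :* I)
    :+ (D₁ :* ((u₁ :- u₃) :* (v₁ :- e)) :+ D₂ :* ((u₂ :- u₃) :* (v₂ :- e))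
        :+ D₃ :* ((u₃ :- u₃) :* (v₃ :- e)) :+ D₄ :* ((u₄ :- u₃) :* (v₄ :- e))) :* I
    := D₁ :* ((u₁ :- u₃) :* I) :* v₁ :+ D₂ :* ((u₂ :- u₃) :* I) :* v₂ :+ D₄ :* ((u₄ :- u₃) :* I) :* v₄)
    refl (fromℕ δ₁) (fromℕ δ₂) (fromℕ δ₃) (fromℕ δ₄) x₁ x₂ x₃ x₄

  pivot₂-barycentric : (nz : Den d x₂ ≢ 0#) → let I = inv (Den d x₂) nz in
    IsBarycentric x₁ y₁ x₃ y₃ x₄ y₄ (pivotX d x₂ nz) (pivotY d x₂ y₂ nz)
      (weight δ₁ x₁ x₂ I) (weight δ₃ x₃ x₂ I) (weight δ₄ x₄ x₂ I)
  pivot₂-barycentric nz =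
    ≡.trans (weight-sum₂ I) DI≡1 , coordinate x₁ x₂ x₃ x₄ , coordinate y₁ y₂ y₃ y₄
    where
    I = inv (Den d x₂) nz
    DI≡1 = inv-r (Den d x₂) nz
    coordinate : ∀ v₁ v₂ v₃ v₄ → v₂ + moment x₂ v₂ v₁ v₂ v₃ v₄ * I
      ≡ weight δ₁ x₁ x₂ I * v₁ + weight δ₃ x₃ x₂ I * v₃ + weight δ₄ x₄ x₂ I * v₄
    coordinate v₁ v₂ v₃ v₄ = ≡.trans (scale-centre v₂ (moment x₂ v₂ v₁ v₂ v₃ v₄) I DI≡1)
                                     (shifted-mean₂ v₁ v₂ v₃ v₄ v₂ I)

  pivot₃-barycentric : (nz : Den d x₃ ≢ 0#) → let I = inv (Den d x₃) nz in
    IsBarycentric x₁ y₁ x₂ y₂ x₄ y₄ (pivotX d x₃ nz) (pivotY d x₃ y₃ nz)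
      (weight δ₁ x₁ x₃ I) (weight δ₂ x₂ x₃ I) (weight δ₄ x₄ x₃ I)
  pivot₃-barycentric nz =
    ≡.trans (weight-sum₃ I) DI≡1 , coordinate x₁ x₂ x₃ x₄ , coordinate y₁ y₂ y₃ y₄
    where
    I = inv (Den d x₃) nz
    DI≡1 = inv-r (Den d x₃) nz
    coordinate : ∀ v₁ v₂ v₃ v₄ → v₃ + moment x₃ v₃ v₁ v₂ v₃ v₄ * I
      ≡ weight δ₁ x₁ x₃ I * v₁ + weight δ₂ x₂ x₃ I * v₂ + weight δ₄ x₄ x₃ I * v₄
    coordinate v₁ v₂ v₃ v₄ = ≡.trans (scale-centre v₃ (moment x₃ v₃ v₁ v₂ v₃ v₄) I DI≡1)
                                     (shifted-mean₃ v₁ v₂ v₃ v₄ v₃ I)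

  FirstOpposite : Carrier → Carrier → Carrier → Set
  FirstOpposite a b c = ((0# ≤ a) × (b ≤ 0#) × (c ≤ 0#)) ⊎ ((a ≤ 0#) × (0# ≤ b) × (0# ≤ c))

  LastOpposite : Carrier → Carrier → Carrier → Set
  LastOpposite a b c = ((0# ≤ a) × (0# ≤ b) × (c ≤ 0#)) ⊎ ((a ≤ 0#) × (b ≤ 0#) × (0# ≤ c))

  transport₃ : ∀ (P : Carrier → Carrier → Carrier → Set) {a b c a′ b′ c′} →
    (a ≡ a′) × (b ≡ b′) × (c ≡ c′) → P a′ b′ c′ → P a b c
  transport₃ P (refl , refl , refl) p = p

  weights₂-region : x₁ ≤ x₂ → x₂ ≤ x₃ → x₃ ≤ x₄ → ∀ I →
    FirstOpposite (weight δ₁ x₁ x₂ I) (weight δ₃ x₃ x₂ I) (weight δ₄ x₄ x₂ I)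
  weights₂-region x₁≤x₂ x₂≤x₃ x₃≤x₄ I with total 0# I
  ... | inj₁ 0≤I = inj₂ (weight-left-nonpos δ₁ x₁≤x₂ 0≤I , weight-right-nonneg δ₃ x₂≤x₃ 0≤I
                        , weight-right-nonneg δ₄ (≤-trans x₂≤x₃ x₃≤x₄) 0≤I)
  ... | inj₂ I≤0 = inj₁ (weight-left-nonneg δ₁ x₁≤x₂ I≤0 , weight-right-nonpos δ₃ x₂≤x₃ I≤0
                        , weight-right-nonpos δ₄ (≤-trans x₂≤x₃ x₃≤x₄) I≤0)

  weights₃-region : x₁ ≤ x₂ → x₂ ≤ x₃ → x₃ ≤ x₄ → ∀ I →
    LastOpposite (weight δ₁ x₁ x₃ I) (weight δ₂ x₂ x₃ I) (weight δ₄ x₄ x₃ I)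
  weights₃-region x₁≤x₂ x₂≤x₃ x₃≤x₄ I with total 0# I
  ... | inj₁ 0≤I = inj₂ (weight-left-nonpos δ₁ (≤-trans x₁≤x₂ x₂≤x₃) 0≤I
                        , weight-left-nonpos δ₂ x₂≤x₃ 0≤I , weight-right-nonneg δ₄ x₃≤x₄ 0≤I)
  ... | inj₂ I≤0 = inj₁ (weight-left-nonneg δ₁ (≤-trans x₁≤x₂ x₂≤x₃) I≤0
                        , weight-left-nonneg δ₂ x₂≤x₃ I≤0 , weight-right-nonpos δ₄ x₃≤x₄ I≤0)

  pivot₂-region : x₁ ≤ x₂ → x₂ ≤ x₃ → x₃ ≤ x₄ →
    (nz : Den d x₂ ≢ 0#) → ¬ Collinear x₁ y₁ x₃ y₃ x₄ y₄ →
    (l₁ l₃ l₄ : Carrier) →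
    IsBarycentric x₁ y₁ x₃ y₃ x₄ y₄ (pivotX d x₂ nz) (pivotY d x₂ y₂ nz) l₁ l₃ l₄ →
    FirstOpposite l₁ l₃ l₄
  pivot₂-region x₁≤x₂ x₂≤x₃ x₃≤x₄ nz non-collinear _ _ _ bary =
    transport₃ FirstOpposite (barycentric-unique non-collinear bary (pivot₂-barycentric nz))
      (weights₂-region x₁≤x₂ x₂≤x₃ x₃≤x₄ (inv (Den d x₂) nz))

  pivot₃-region : x₁ ≤ x₂ → x₂ ≤ x₃ → x₃ ≤ x₄ →
    (nz : Den d x₃ ≢ 0#) → ¬ Collinear x₁ y₁ x₂ y₂ x₄ y₄ →
    (l₁ l₂ l₄ : Carrier) →
    IsBarycentric x₁ y₁ x₂ y₂ x₄ y₄ (pivotX d x₃ nz) (pivotY d x₃ y₃ nz) l₁ l₂ l₄ →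
    LastOpposite l₁ l₂ l₄
  pivot₃-region x₁≤x₂ x₂≤x₃ x₃≤x₄ nz non-collinear _ _ _ bary =
    transport₃ LastOpposite (barycentric-unique non-collinear bary (pivot₃-barycentric nz))
      (weights₃-region x₁≤x₂ x₂≤x₃ x₃≤x₄ (inv (Den d x₃) nz))

proposition3 : (F : OrderedField) (d : Pivot.Data4 F) →
    let open OrderedField F
        open Pivot F
        open Data4 d
    in x₁ ≤ x₂ → x₂ ≤ x₃ → x₃ ≤ x₄ →
       1 ℕ.≤ δ₁ → 1 ℕ.≤ δ₂ → 1 ℕ.≤ δ₃ → 1 ℕ.≤ δ₄ →
       ((nz : Den d x₂ ≢ 0#) → ¬ Collinear x₁ y₁ x₃ y₃ x₄ y₄ →
          (l₁ l₃ l₄ : Carrier) →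
          IsBarycentric x₁ y₁ x₃ y₃ x₄ y₄ (pivotX d x₂ nz) (pivotY d x₂ y₂ nz) l₁ l₃ l₄ →
          ((0# ≤ l₁) × (l₃ ≤ 0#) × (l₄ ≤ 0#)) ⊎ ((l₁ ≤ 0#) × (0# ≤ l₃) × (0# ≤ l₄)))
       ×
       ((nz : Den d x₃ ≢ 0#) → ¬ Collinear x₁ y₁ x₂ y₂ x₄ y₄ →
          (l₁ l₂ l₄ : Carrier) →
          IsBarycentric x₁ y₁ x₂ y₂ x₄ y₄ (pivotX d x₃ nz) (pivotY d x₃ y₃ nz) l₁ l₂ l₄ →
          ((0# ≤ l₁) × (0# ≤ l₂) × (l₄ ≤ 0#)) ⊎ ((l₁ ≤ 0#) × (l₂ ≤ 0#) × (0# ≤ l₄)))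
proposition3 F d x₁≤x₂ x₂≤x₃ x₃≤x₄ _ _ _ _ =
    pivot₂-region x₁≤x₂ x₂≤x₃ x₃≤x₄
  , pivot₃-region x₁≤x₂ x₂≤x₃ x₃≤x₄
  where open PivotRegions F d
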